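{- Let $C_1,C_2,C_3$ be cycles of odd length in a graph with $|C_1|\equiv|C_2|\equiv|C_3|\pmod 4$, such that any two of them intersect exactly in a common vertex $x$. For $i=1,2,3$ (indices modulo $3$), let $P_i$ be a path from $C_i$ to $C_{i+1}$ that is vertex-disjoint from $C_{i+2}$, and suppose $P_1,P_2,P_3$ are pairwise internally-disjoint. Then $C_1\cup C_2\cup C_3\cup P_1\cup P_2\cup P_3$ contains a cycle whose length is divisible by $4$.
   Context: Graphs are finite and simple; lengths count edges. For subgraphs $X,Y$, a path from $X$ to $Y$ is a path with one end-vertex in $X$, the other in $Y$, and all internal vertices outside $V(X)\cup V(Y)$. -}

module Defs where

open import Data.Nat using (ℕ; zero; suc; _≤_)
open import Data.Fin using (Fin)
open import Data.List using (List; []; _∷_; _++_; length)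
open import Data.List.Membership.Propositional using (_∈_)
open import Data.List.Relation.Unary.Unique.Propositional using (Unique)
open import Data.Product using (_×_)
open import Data.Sum using (_⊎_)
open import Relation.Nullary using (¬_)
open import Relation.Binary.PropositionalEquality using (_≡_; _≢_)

record Graph : Set₁ where
  field
    n      : ℕ
    Adj    : Fin n → Fin n → Set
    sym    : ∀ {u v} → Adj u v → Adj v u
    irrefl : ∀ {v} → ¬ Adj v v

data Consec {A : Set} (u v : A) : List A → Set where
  here  : ∀ {xs} → Consec u v (u ∷ v ∷ xs)
  there : ∀ {y xs} → Consec u v xs → Consec u v (y ∷ xs)

lastOf : {A : Set} → A → List A → A
lastOf a []       = a
lastOf a (b ∷ bs) = lastOf b bs

module _ (G : Graph) where
  open Graph G

  V : Set
  V = Fin n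

  record Path : Set where
    field
      start : V
      rest  : List V
      uniq  : Unique (start ∷ rest)
      adj   : ∀ {u v} → Consec u v (start ∷ rest) → Adj u v

  -- A cycle v₀ v₁ … v_{k-1} v₀ with k ≥ 3 distinct vertices; length k.
  record Cycle : Set where
    field
      start : V
      rest  : List V
      long  : 2 ≤ length rest
      uniq  : Unique (start ∷ rest)
      adj   : ∀ {u v} → Consec u v (start ∷ rest ++ start ∷ []) → Adj u v

  pathLength : Path → ℕ
  pathLength P = length (Path.rest P)

  cycleLength : Cycle → ℕ
  cycleLength C = suc (length (Cycle.rest C))

  InPath : V → Path → Set
  InPath v P = v ∈ (Path.start P ∷ Path.rest P)

  InCycle : V → Cycle → Set
  InCycle v C = v ∈ (Cycle.start C ∷ Cycle.rest C)

  pathEnd : Path → V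
  pathEnd P = lastOf (Path.start P) (Path.rest P)

  IsEnd : Path → V → Set
  IsEnd P v = (v ≡ Path.start P) ⊎ (v ≡ pathEnd P)

  Inner : Path → V → Set
  Inner P v = InPath v P × v ≢ Path.start P × v ≢ pathEnd P

  PathEdge : Path → V → V → Set
  PathEdge P u v = Consec u v (Path.start P ∷ Path.rest P)
                 ⊎ Consec v u (Path.start P ∷ Path.rest P)

  CycleEdge : Cycle → V → V → Set
  CycleEdge C u v = Consec u v (Cycle.start C ∷ Cycle.rest C ++ Cycle.start C ∷ [])
                  ⊎ Consec v u (Cycle.start C ∷ Cycle.rest C ++ Cycle.start C ∷ [])

  PathBetween : Path → Cycle → Cycle → Set
  PathBetween P X Y =
    ((InCycle (Path.start P) X × InCycle (pathEnd P) Y)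
      ⊎ (InCycle (Path.start P) Y × InCycle (pathEnd P) X))
    × (∀ v → Inner P v → ¬ InCycle v X × ¬ InCycle v Y)

  VertexDisjointPC : Path → Cycle → Set
  VertexDisjointPC P C = ∀ v → InPath v P → ¬ InCycle v C

  InternallyDisjoint : Path → Path → Set
  InternallyDisjoint P Q = ∀ v → InPath v P → InPath v Q → IsEnd P v × IsEnd Q v

  MeetExactlyIn : Cycle → Cycle → V → Set
  MeetExactlyIn C D x = InCycle x C × InCycle x D × (∀ v → InCycle v C → InCycle v D → v ≡ x)

{-# OPTIONS --safe #-}
-- Every attachment point t ≠ x on an odd cycle C splits C into two x–t arcs of opposite
-- parity whose lengths add up to |C|. A bridge from C to C′ (some Pᵢ, or Pᵢ followed by a
-- path Dᵢ₊₁ through Cᵢ₊₁ − x and by Pᵢ₊₁) closes up with an arc of C and an arc of C′ to a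
-- cycle. If a bridge has even length, the cycle through both even arcs and the one through
-- both odd arcs are even and their lengths add up to |C| + |C′| + 2|bridge| ≡ 2 (mod 4), so
-- one of them is divisible by 4. Otherwise all six bridges are odd, and the six cycles through
-- an even and an odd arc are even; if none of them is divisible by 4, all are ≡ 2 (mod 4).
-- The cycle P₁ D₂ P₂ D₃ P₃ D₁ together with the three cycles through a single Pᵢ has the same
-- total length as the three cycles through the long bridges, so it is divisible by 4.
-- Since the hypotheses are invariant under cyclically shifting the indices, each kind of
-- cycle is only built for the bridges starting on C₁.
module Submission where

open import Level using (0ℓ)
open import Data.Nat using (ℕ; suc; _+_; _%_; _<_; _≤_; s≤s; z≤n; NonZero)
open import Data.Nat.Properties using (+-comm; +-mono-≤; suc-injective; ≤-pred)
open import Data.Nat.DivMod using (%-distribˡ-+; m%n<n; m∣n⇒o%n%m≡o%m)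
open import Data.Nat.Divisibility using (_∣_; divides; m%n≡0⇒n∣m)
open import Data.Nat.Tactic.RingSolver using (solve-∀)
open import Data.Fin.Properties using (_≟_)
open import Data.List using (List; []; _∷_; _++_; _∷ʳ_; length; reverse; _ʳ++_)
open import Data.List.Properties using (length-++; length-reverse)
open import Data.List.Membership.Propositional using (_∈_; _∉_)
open import Data.List.Membership.Propositional.Properties using (∈-++⁺ˡ; ∈-++⁺ʳ; ∈-++⁻)
open import Data.List.Relation.Unary.Any using (here; there)
open import Data.List.Relation.Unary.All using (lookup)
import Data.List.Relation.Unary.All.Properties as All
open import Data.List.Relation.Unary.All.Properties.Core using (¬Any⇒All¬)
import Data.List.Relation.Unary.AllPairs as AllPairs
open import Data.List.Relation.Unary.Unique.Propositional using (Unique; []; _∷_)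
open import Data.List.Relation.Unary.Unique.Propositional.Properties using (++⁺; Unique[x∷xs]⇒x∉xs)
open import Data.List.Relation.Binary.Disjoint.Propositional using (Disjoint)
open import Data.List.Relation.Binary.Permutation.Propositional using (_↭_; ↭-sym; ↭-trans; ↭⇒↭ₛ)
open import Data.List.Relation.Binary.Permutation.Propositional.Properties
  using (∈-resp-↭; ↭-reverse; ↭-length; ++-comm; ∷↭∷ʳ)
import Data.List.Relation.Binary.Permutation.Setoid.Properties as PermutationSetoid
open import Data.Product using (Σ; Σ-syntax; _×_; _,_; proj₁; proj₂)
open import Data.Sum using (_⊎_; inj₁; inj₂; [_,_]′; swap)
import Data.Sum
open import Data.Empty using (⊥-elim)
open import Function using (_∘_; id)
open import Relation.Nullary using (yes; no)
open import Relation.Unary using (Pred; _∪_; _∩_; _∖_; ｛_｝; _⊆_)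
open import Relation.Binary using (Rel; Symmetric; _⇒_)
open import Relation.Binary.PropositionalEquality
open import Relation.Binary.Construct.Closure.ReflexiveTransitive as Star using (Star; ε; _◅_; _◅◅_)
open import Defs

module _ {A : Set} where

  Unique-resp-↭ : ∀ {xs ys : List A} → xs ↭ ys → Unique xs → Unique ys
  Unique-resp-↭ p = PermutationSetoid.Unique-resp-↭ (setoid A) (↭⇒↭ₛ p)

  ∷-unique : ∀ {x : A} {xs} → x ∉ xs → Unique xs → Unique (x ∷ xs)
  ∷-unique {xs = xs} x∉xs u = ¬Any⇒All¬ xs x∉xs ∷ u

  ++-unique⁻ : ∀ xs {ys : List A} → Unique (xs ++ ys) → Unique xs × Unique ys × Disjoint xs ys
  ++-unique⁻ []       u        = [] , u , λ ()
  ++-unique⁻ (x ∷ xs) (x∉ ∷ u) with ++-unique⁻ xs u | All.++⁻ xs x∉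
  ... | uxs , uys , xs#ys | x∉xs , x∉ys = ∷-unique (λ x∈xs → lookup x∉xs x∈xs refl) uxs , uys , x∷xs#ys
    where
    x∷xs#ys : Disjoint (x ∷ xs) _
    x∷xs#ys (here refl  , v∈ys) = lookup x∉ys v∈ys refl
    x∷xs#ys (there v∈xs , v∈ys) = xs#ys (v∈xs , v∈ys)

  lastOf-∷ʳ : ∀ (a : A) xs b → lastOf a (xs ∷ʳ b) ≡ b
  lastOf-∷ʳ a []       b = refl
  lastOf-∷ʳ a (x ∷ xs) b = lastOf-∷ʳ x xs b

module _ {V : Set} {R : Rel V 0ℓ} where

  targets : ∀ {a b} → Star R a b → List V
  targets ε                 = []
  targets (_◅_ {j = j} _ w) = j ∷ targets w

  vertices : ∀ {a b} → Star R a b → List V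
  vertices {a} w = a ∷ targets w

  len : ∀ {a b} → Star R a b → ℕ
  len w = length (targets w)

  targets-◅◅ : ∀ {a b c} (w : Star R a b) (w′ : Star R b c) → targets (w ◅◅ w′) ≡ targets w ++ targets w′
  targets-◅◅ ε       w′ = refl
  targets-◅◅ (r ◅ w) w′ = cong (_ ∷_) (targets-◅◅ w w′)

  vertices-◅◅ : ∀ {a b c} (w : Star R a b) (w′ : Star R b c) → vertices (w ◅◅ w′) ≡ vertices w ++ targets w′
  vertices-◅◅ w w′ = cong (_ ∷_) (targets-◅◅ w w′)

  len-◅◅ : ∀ {a b c} (w : Star R a b) (w′ : Star R b c) → len (w ◅◅ w′) ≡ len w + len w′
  len-◅◅ w w′ = trans (cong length (targets-◅◅ w w′)) (length-++ (targets w))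

  targets-last : ∀ {a j b} (r : R a j) (w : Star R j b) → Σ[ rest ∈ List V ] targets (r ◅ w) ≡ rest ∷ʳ b
  targets-last r ε       = [] , refl
  targets-last {j = j} r (s ◅ w) with targets-last s w
  ... | rest , eq = j ∷ rest , cong (j ∷_) eq

  end∈vertices : ∀ {a b} (w : Star R a b) → b ∈ vertices w
  end∈vertices ε       = here refl
  end∈vertices (r ◅ w) = there (end∈vertices w)

  end∈targets : ∀ {a b} → a ≢ b → (w : Star R a b) → b ∈ targets w
  end∈targets a≢b ε       = ⊥-elim (a≢b refl)
  end∈targets a≢b (r ◅ w) = end∈vertices w

  len-positive : ∀ {a b} → a ≢ b → (w : Star R a b) → 1 ≤ len w
  len-positive a≢b ε       = ⊥-elim (a≢b refl)
  len-positive a≢b (r ◅ w) = s≤s z≤n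

  ∈-◅◅⁺ˡ : ∀ {a b c v} (w : Star R a b) (w′ : Star R b c) → v ∈ vertices w → v ∈ vertices (w ◅◅ w′)
  ∈-◅◅⁺ˡ {v = v} w w′ v∈w = subst (v ∈_) (sym (vertices-◅◅ w w′)) (∈-++⁺ˡ v∈w)

  ∈-◅◅⁺ʳ : ∀ {a b c v} (w : Star R a b) (w′ : Star R b c) → v ∈ vertices w′ → v ∈ vertices (w ◅◅ w′)
  ∈-◅◅⁺ʳ         w w′ (here refl)  = ∈-◅◅⁺ˡ w w′ (end∈vertices w)
  ∈-◅◅⁺ʳ {v = v} w w′ (there v∈w′) = subst (v ∈_) (sym (vertices-◅◅ w w′)) (∈-++⁺ʳ (vertices w) v∈w′)

  ∈-◅◅⁻ : ∀ {a b c v} (w : Star R a b) (w′ : Star R b c) →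
          v ∈ vertices (w ◅◅ w′) → v ∈ vertices w ⊎ v ∈ targets w′
  ∈-◅◅⁻ {v = v} w w′ v∈ = ∈-++⁻ (vertices w) (subst (v ∈_) (vertices-◅◅ w w′) v∈)

  split : ∀ {a b t} (w : Star R a b) → t ∈ vertices w →
          Σ[ w₁ ∈ Star R a t ] Σ[ w₂ ∈ Star R t b ] w ≡ w₁ ◅◅ w₂
  split w       (here refl) = ε , w , refl
  split (r ◅ w) (there t∈w) with split w t∈w
  ... | w₁ , w₂ , refl = r ◅ w₁ , w₂ , refl

  consecutive : ∀ {a b u v} (w : Star R a b) → Consec u v (vertices w) → R u v
  consecutive ε             (there ())
  consecutive (r ◅ ε)       here      = r
  consecutive (r ◅ (_ ◅ _)) here      = r
  consecutive (r ◅ w)       (there c) = consecutive w c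

  walkAlong : ∀ s rs → (∀ {u v} → Consec u v (s ∷ rs) → R u v) →
              Σ[ w ∈ Star R s (lastOf s rs) ] targets w ≡ rs
  walkAlong s []       adj = ε , refl
  walkAlong s (r ∷ rs) adj with walkAlong r rs (adj ∘ there)
  ... | w , w≡rs = adj here ◅ w , cong (r ∷_) w≡rs

  module _ (R-sym : Symmetric R) where

    vertices-revApp : ∀ {i j k} (w : Star R j i) (acc : Star R j k) →
                      vertices (Star.revApp R-sym w acc) ≡ targets w ʳ++ vertices acc
    vertices-revApp ε       acc = refl
    vertices-revApp (r ◅ w) acc = vertices-revApp w (R-sym r ◅ acc)

    vertices-reverse : ∀ {a b} (w : Star R a b) → vertices (Star.reverse R-sym w) ≡ reverse (vertices w)
    vertices-reverse w = vertices-revApp w ε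

    len-reverse : ∀ {a b} (w : Star R a b) → len (Star.reverse R-sym w) ≡ len w
    len-reverse w = suc-injective (trans (cong length (vertices-reverse w)) (length-reverse (vertices w)))

module _ {V : Set} {R R′ : Rel V 0ℓ} (f : R ⇒ R′) where

  targets-map : ∀ {a b} (w : Star R a b) → targets (Star.map f w) ≡ targets w
  targets-map ε       = refl
  targets-map (r ◅ w) = cong (_ ∷_) (targets-map w)

  vertices-map : ∀ {a b} (w : Star R a b) → vertices (Star.map f w) ≡ vertices w
  vertices-map w = cong (_ ∷_) (targets-map w)

  len-map : ∀ {a b} (w : Star R a b) → len (Star.map f w) ≡ len w
  len-map w = cong length (targets-map w)

module _ {V : Set} where

  record SimplePath (R : Rel V 0ℓ) (P : Pred V 0ℓ) (a b : V) : Set where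
    field
      walk   : Star R a b
      unique : Unique (vertices walk)
      inside : ∀ {v} → v ∈ vertices walk → P v

  open SimplePath public

  record Circuit (R : Rel V 0ℓ) (P : Pred V 0ℓ) (a : V) : Set where
    field
      walk   : Star R a a
      unique : Unique (targets walk)
      inside : ∀ {v} → v ∈ vertices walk → P v

module _ {V : Set} {R : Rel V 0ℓ} where

  ∣_∣ : ∀ {P a b} → SimplePath R P a b → ℕ
  ∣ p ∣ = len (walk p)

  join : ∀ {P Q a b c} (p : SimplePath R P a b) (q : SimplePath R Q b c) →
         P ∩ Q ⊆ ｛ b ｝ → SimplePath R (P ∪ Q) a c
  join p q P∩Q⊆b = record
    { walk   = walk p ◅◅ walk q
    ; unique = subst Unique (sym (vertices-◅◅ (walk p) (walk q)))
                 (++⁺ (unique p) (AllPairs.tail (unique q)) disjoint)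
    ; inside = λ v∈ → [ inj₁ ∘ inside p , inj₂ ∘ inside q ∘ there ]′ (∈-◅◅⁻ (walk p) (walk q) v∈)
    }
    where
    disjoint : Disjoint (vertices (walk p)) (targets (walk q))
    disjoint (v∈p , v∈q) with P∩Q⊆b (inside p v∈p , inside q (there v∈q))
    ... | refl = Unique[x∷xs]⇒x∉xs (unique q) v∈q

  prefix : ∀ {P a b t} (p : SimplePath R P a b) → t ∈ vertices (walk p) → t ≢ b →
           SimplePath R (P ∖ ｛ b ｝) a t
  prefix p t∈p t≢b with split (walk p) t∈p
  ... | w₁ , w₂ , p≡w₁w₂ = record
    { walk   = w₁
    ; unique = proj₁ parts
    ; inside = λ v∈w₁ → inside p (on-p (∈-◅◅⁺ˡ w₁ w₂ v∈w₁))
                       , λ { refl → proj₂ (proj₂ parts) (v∈w₁ , end∈targets t≢b w₂) }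
    }
    where
    on-p : ∀ {v} → v ∈ vertices (w₁ ◅◅ w₂) → v ∈ vertices (walk p)
    on-p {v} = subst (λ w → v ∈ vertices w) (sym p≡w₁w₂)
    parts = ++-unique⁻ (vertices w₁) (subst Unique (trans (cong vertices p≡w₁w₂) (vertices-◅◅ w₁ w₂)) (unique p))

  close : ∀ {P Q a b} (p : SimplePath R P a b) (q : SimplePath R Q b a) →
          P ∩ Q ⊆ ｛ a ｝ ∪ ｛ b ｝ → Circuit R (P ∪ Q) a
  close p q P∩Q⊆ab = record
    { walk   = walk p ◅◅ walk q
    ; unique = subst Unique (sym (targets-◅◅ (walk p) (walk q)))
                 (++⁺ (AllPairs.tail (unique p)) (AllPairs.tail (unique q)) disjoint)
    ; inside = λ v∈ → [ inj₁ ∘ inside p , inj₂ ∘ inside q ∘ there ]′ (∈-◅◅⁻ (walk p) (walk q) v∈)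
    }
    where
    disjoint : Disjoint (targets (walk p)) (targets (walk q))
    disjoint (v∈p , v∈q) with P∩Q⊆ab (inside p (there v∈p) , inside q (there v∈q))
    ... | inj₁ refl = Unique[x∷xs]⇒x∉xs (unique p) v∈p
    ... | inj₂ refl = Unique[x∷xs]⇒x∉xs (unique q) v∈q

  rotate : ∀ {P a t} (c : Circuit R P a) → t ∈ targets (Circuit.walk c) →
           Σ[ c′ ∈ Circuit R P t ] targets (Circuit.walk c′) ↭ targets (Circuit.walk c)
  rotate {t = t} c t∈c with split (Circuit.walk c) (there t∈c)
  ... | w₁ , w₂ , c≡w₁w₂ = c′ , rotated
    where
    rotated : targets (w₂ ◅◅ w₁) ↭ targets (Circuit.walk c)
    rotated = subst₂ _↭_ (sym (targets-◅◅ w₂ w₁)) (sym (trans (cong targets c≡w₁w₂) (targets-◅◅ w₁ w₂)))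
                (++-comm (targets w₂) (targets w₁))
    c′ : Circuit R _ t
    c′ = record
      { walk   = w₂ ◅◅ w₁
      ; unique = Unique-resp-↭ (↭-sym rotated) (Circuit.unique c)
      ; inside = λ { (here refl) → Circuit.inside c (there t∈c)
                   ; (there v∈) → Circuit.inside c (there (∈-resp-↭ rotated v∈)) }
      }

  record Cut {P a} (c : Circuit R P a) (t : V) : Set where
    field
      forth   : SimplePath R P a t
      back    : SimplePath R P t a
      lengths : ∣ forth ∣ + ∣ back ∣ ≡ len (Circuit.walk c)
      covers  : ∀ {v} → v ∈ vertices (Circuit.walk c) → v ∈ vertices (walk forth) ⊎ v ∈ vertices (walk back)

  cut : ∀ {P a t} (c : Circuit R P a) → t ∈ targets (Circuit.walk c) → t ≢ a → Cut c t
  cut c t∈c t≢a with split (Circuit.walk c) (there t∈c)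
  ... | w₁ , w₂ , c≡w₁w₂ = record
    { forth   = record { walk = w₁ ; unique = ∷-unique (λ a∈w₁ → w₁#w₂ (a∈w₁ , end∈targets t≢a w₂)) u₁
                       ; inside = Circuit.inside c ∘ on-c ∘ ∈-◅◅⁺ˡ w₁ w₂ }
    ; back    = record { walk = w₂ ; unique = ∷-unique (λ t∈w₂ → w₁#w₂ (end∈targets (t≢a ∘ sym) w₁ , t∈w₂)) u₂
                       ; inside = Circuit.inside c ∘ on-c ∘ ∈-◅◅⁺ʳ w₁ w₂ }
    ; lengths = sym (trans (cong len c≡w₁w₂) (len-◅◅ w₁ w₂))
    ; covers  = λ v∈c → Data.Sum.map₂ there (∈-◅◅⁻ w₁ w₂ (subst (λ w → _ ∈ vertices w) c≡w₁w₂ v∈c))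
    }
    where
    on-c : ∀ {v} → v ∈ vertices (w₁ ◅◅ w₂) → v ∈ vertices (Circuit.walk c)
    on-c {v} = subst (λ w → v ∈ vertices w) (sym c≡w₁w₂)
    parts = ++-unique⁻ (targets w₁) (subst Unique (trans (cong targets c≡w₁w₂) (targets-◅◅ w₁ w₂)) (Circuit.unique c))
    u₁ = proj₁ parts
    u₂ = proj₁ (proj₂ parts)
    w₁#w₂ = proj₂ (proj₂ parts)

  module _ (R-sym : Symmetric R) where

    reversed : ∀ {P a b} → SimplePath R P a b → SimplePath R P b a
    reversed p = record
      { walk   = Star.reverse R-sym (walk p)
      ; unique = subst Unique (sym (vertices-reverse R-sym (walk p)))
                   (Unique-resp-↭ (↭-sym (↭-reverse _)) (unique p))
      ; inside = λ v∈ → inside p (∈-resp-↭ (↭-reverse _) (subst (_ ∈_) (vertices-reverse R-sym (walk p)) v∈))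
      }

    ∣reversed∣ : ∀ {P a b} (p : SimplePath R P a b) → ∣ reversed p ∣ ≡ ∣ p ∣
    ∣reversed∣ p = len-reverse R-sym (walk p)

    ∈-reversed : ∀ {P a b v} (p : SimplePath R P a b) → v ∈ vertices (walk p) → v ∈ vertices (walk (reversed p))
    ∈-reversed p v∈p = subst (_ ∈_) (sym (vertices-reverse R-sym (walk p))) (∈-resp-↭ (↭-sym (↭-reverse _)) v∈p)

module _ {V : Set} {R R′ : Rel V 0ℓ} (f : R ⇒ R′) where

  mapEdges : ∀ {P a b} → SimplePath R P a b → SimplePath R′ P a b
  mapEdges p = record
    { walk   = Star.map f (walk p)
    ; unique = subst Unique (sym (vertices-map f (walk p))) (unique p)
    ; inside = λ {v} → inside p ∘ subst (v ∈_) (vertices-map f (walk p))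
    }

  ∣mapEdges∣ : ∀ {P a b} (p : SimplePath R P a b) → ∣ mapEdges p ∣ ≡ ∣ p ∣
  ∣mapEdges∣ p = len-map f (walk p)

module _ (G : Graph) where

  open Graph G using (Adj) renaming (sym to Adj-sym)

  onCycle : Cycle G → Pred (V G) 0ℓ
  onCycle C v = InCycle G v C

  onPath : Path G → Pred (V G) 0ℓ
  onPath P v = InPath G v P

  CycleEdge-sym : (C : Cycle G) → Symmetric (CycleEdge G C)
  CycleEdge-sym C = swap

  PathEdge-sym : (P : Path G) → Symmetric (PathEdge G P)
  PathEdge-sym P = swap

  CycleEdge⇒Adj : (C : Cycle G) → CycleEdge G C ⇒ Adj
  CycleEdge⇒Adj C = [ Cycle.adj C , Adj-sym ∘ Cycle.adj C ]′

  PathEdge⇒Adj : (P : Path G) → PathEdge G P ⇒ Adj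
  PathEdge⇒Adj P = [ Path.adj P , Adj-sym ∘ Path.adj P ]′

  pathWalk : (P : Path G) → SimplePath (PathEdge G P) (onPath P) (Path.start P) (pathEnd G P)
  pathWalk P with walkAlong (Path.start P) (Path.rest P) inj₁
  ... | w , w≡rest = record
    { walk   = w
    ; unique = subst Unique (cong (_ ∷_) (sym w≡rest)) (Path.uniq P)
    ; inside = λ {v} → subst (v ∈_) (cong (_ ∷_) w≡rest)
    }

  cycleCircuit : (C : Cycle G) →
                 Σ[ c ∈ Circuit (CycleEdge G C) (onCycle C) (Cycle.start C) ]
                   targets (Circuit.walk c) ↭ Cycle.start C ∷ Cycle.rest C
  cycleCircuit C with subst (λ e → Σ[ w ∈ Star (CycleEdge G C) s e ] targets w ≡ rs ∷ʳ s)
                            (lastOf-∷ʳ s rs s) (walkAlong s (rs ∷ʳ s) inj₁)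
    where
    s = Cycle.start C
    rs = Cycle.rest C
  ... | w , w≡rest = record
    { walk   = w
    ; unique = Unique-resp-↭ (↭-sym targets↭) (Cycle.uniq C)
    ; inside = λ { (here refl) → here refl ; (there v∈) → ∈-resp-↭ targets↭ v∈ }
    } , targets↭
    where
    targets↭ : targets w ↭ Cycle.start C ∷ Cycle.rest C
    targets↭ = subst (_↭ _) (sym w≡rest) (↭-sym (∷↭∷ʳ _ _))

  module _ {R : Rel (V G) 0ℓ} (R-sym : Symmetric R) (R⇒Adj : R ⇒ Adj) where

    toCycle : ∀ {x} (w : Star R x x) → Unique (targets w) → 3 ≤ len w →
              Σ[ D ∈ Cycle G ] (∀ u v → CycleEdge G D u v → R u v) × cycleLength G D ≡ len w
    toCycle ε       _    ()
    toCycle {x} (r ◅ w) uniq three with targets-last r w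
    ... | rest , t≡rest = D , edges , trans (↭-length (∷↭∷ʳ x rest)) (cong length (sym t≡rest))
      where
      step : ∀ {u v} → Consec u v (x ∷ rest ∷ʳ x) → R u v
      step c = consecutive (r ◅ w) (subst (Consec _ _) (cong (x ∷_) (sym t≡rest)) c)
      D : Cycle G
      D = record
        { start = x
        ; rest  = rest
        ; long  = ≤-pred (subst (3 ≤_) (trans (cong length t≡rest) (sym (↭-length (∷↭∷ʳ x rest)))) three)
        ; uniq  = Unique-resp-↭ (↭-sym (∷↭∷ʳ x rest)) (subst Unique t≡rest uniq)
        ; adj   = R⇒Adj ∘ step
        }
      edges : ∀ u v → CycleEdge G D u v → R u v
      edges u v = [ step , R-sym ∘ step ]′

  apart : ∀ X Y {x u v} → onCycle X ∩ onCycle Y ⊆ ｛ x ｝ → InCycle G u X → InCycle G v Y → u ≢ x → u ≢ v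
  apart X Y X∩Y⊆x u∈X v∈Y u≢x refl = u≢x (sym (X∩Y⊆x (u∈X , v∈Y)))

  record Oriented (P : Path G) (X Y : Cycle G) : Set where
    field
      {from to} : V G
      route     : SimplePath (PathEdge G P) (onPath P) from to
      from∈X    : InCycle G from X
      to∈Y      : InCycle G to Y
      ends      : IsEnd G P ⊆ ｛ from ｝ ∪ ｛ to ｝
      meets     : onPath P ∩ (onCycle X ∪ onCycle Y) ⊆ ｛ from ｝ ∪ ｛ to ｝

  meetsOnlyAtEnds : ∀ {P X Y} → PathBetween G P X Y →
                    onPath P ∩ (onCycle X ∪ onCycle Y) ⊆ ｛ Path.start P ｝ ∪ ｛ pathEnd G P ｝
  meetsOnlyAtEnds {P} (_ , inner) {v} (v∈P , v∈X∪Y) with v ≟ Path.start P | v ≟ pathEnd G P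
  ... | yes v≡s | _       = inj₁ (sym v≡s)
  ... | no _    | yes v≡e = inj₂ (sym v≡e)
  ... | no v≢s  | no v≢e  = ⊥-elim ([ proj₁ outside , proj₂ outside ]′ v∈X∪Y)
    where outside = inner v (v∈P , v≢s , v≢e)

  orient : ∀ {P X Y} → PathBetween G P X Y → Oriented P X Y
  orient {P} {X} {Y} between@(endpoints , _) with endpoints
  ... | inj₁ (s∈X , e∈Y) = record
    { route = pathWalk P ; from∈X = s∈X ; to∈Y = e∈Y
    ; ends  = Data.Sum.map sym sym ; meets = meetsOnlyAtEnds {P} {X} {Y} between }
  ... | inj₂ (s∈Y , e∈X) = record
    { route = reversed (PathEdge-sym P) (pathWalk P) ; from∈X = e∈X ; to∈Y = s∈Y
    ; ends  = swap ∘ Data.Sum.map sym sym ; meets = swap ∘ meetsOnlyAtEnds {P} {X} {Y} between }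

  module _ (C : Cycle G) {x : V G} (x∈C : InCycle G x C) where

    circuitAt : Σ[ c ∈ Circuit (CycleEdge G C) (onCycle C) x ]
                  targets (Circuit.walk c) ↭ Cycle.start C ∷ Cycle.rest C
    circuitAt with cycleCircuit C
    ... | c , c↭C with rotate c (∈-resp-↭ (↭-sym c↭C) x∈C)
    ...   | c′ , c′↭c = c′ , ↭-trans c′↭c c↭C

    private
      cutAt : ∀ {t} → InCycle G t C → t ≢ x → Cut (proj₁ circuitAt) t
      cutAt t∈C = cut (proj₁ circuitAt) (∈-resp-↭ (↭-sym (proj₂ circuitAt)) t∈C)

    arcs : ∀ {t} → InCycle G t C → t ≢ x →
           Σ[ p ∈ SimplePath (CycleEdge G C) (onCycle C) x t ]
           Σ[ q ∈ SimplePath (CycleEdge G C) (onCycle C) x t ] ∣ p ∣ + ∣ q ∣ ≡ cycleLength G C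
    arcs t∈C t≢x = Cut.forth k , reversed (CycleEdge-sym C) (Cut.back k) , lengths
      where
      k = cutAt t∈C t≢x
      lengths : ∣ Cut.forth k ∣ + ∣ reversed (CycleEdge-sym C) (Cut.back k) ∣ ≡ cycleLength G C
      lengths = trans (cong (∣ Cut.forth k ∣ +_) (∣reversed∣ (CycleEdge-sym C) (Cut.back k)))
                      (trans (Cut.lengths k) (↭-length (proj₂ circuitAt)))

    arcAvoiding : ∀ {u v} → InCycle G u C → u ≢ x → InCycle G v C → v ≢ x →
             SimplePath (CycleEdge G C) (onCycle C ∖ ｛ x ｝) u v
    arcAvoiding u∈C u≢x v∈C v≢x =
      [ (λ v∈forth → prefix (reversed (CycleEdge-sym C) (Cut.forth k))
                             (∈-reversed (CycleEdge-sym C) (Cut.forth k) v∈forth) v≢x)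
      , (λ v∈back → prefix (Cut.back k) v∈back v≢x)
      ]′ (Cut.covers k (there (∈-resp-↭ (↭-sym (proj₂ circuitAt)) v∈C)))
      where k = cutAt u∈C u≢x

+-mod : ∀ d .{{_ : NonZero d}} a b {r s} → a % d ≡ r → b % d ≡ s → (a + b) % d ≡ (r + s) % d
+-mod d a b refl refl = %-distribˡ-+ a b d

parity-split : ∀ m n → (m + n) % 2 ≡ 1 → (m % 2 ≡ 0 × n % 2 ≡ 1) ⊎ (m % 2 ≡ 1 × n % 2 ≡ 0)
parity-split m n odd = residues (m % 2) (n % 2) (m%n<n m 2) (m%n<n n 2) (trans (sym (+-mod 2 m n refl refl)) odd)
  where
  residues : ∀ r s → r < 2 → s < 2 → (r + s) % 2 ≡ 1 → (r ≡ 0 × s ≡ 1) ⊎ (r ≡ 1 × s ≡ 0)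
  residues 0 1 _ _ _ = inj₁ (refl , refl)
  residues 1 0 _ _ _ = inj₂ (refl , refl)
  residues 0 0 _ _ ()
  residues 1 1 _ _ ()
  residues (suc (suc _)) _ (s≤s (s≤s ())) _ _
  residues _ (suc (suc _)) _ (s≤s (s≤s ())) _

parity : ∀ n → n % 2 ≡ 0 ⊎ n % 2 ≡ 1
parity n = residue (n % 2) (m%n<n n 2) refl
  where
  residue : ∀ r → r < 2 → n % 2 ≡ r → n % 2 ≡ 0 ⊎ n % 2 ≡ 1
  residue 0 _ n≡r = inj₁ n≡r
  residue 1 _ n≡r = inj₂ n≡r
  residue (suc (suc _)) (s≤s (s≤s ())) _

%4-parity : ∀ n {r} → n % 4 ≡ r → n % 2 ≡ r % 2
%4-parity n refl = sym (m∣n⇒o%n%m≡o%m 2 4 n (divides 2 refl))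

even-mod4 : ∀ n → n % 2 ≡ 0 → n % 4 ≡ 0 ⊎ n % 4 ≡ 2
even-mod4 n even = residue (n % 4) (m%n<n n 4) refl
  where
  residue : ∀ r → r < 4 → n % 4 ≡ r → n % 4 ≡ 0 ⊎ n % 4 ≡ 2
  residue 0 _ n≡r = inj₁ n≡r
  residue 2 _ n≡r = inj₂ n≡r
  residue 1 _ n≡r with trans (sym (%4-parity n n≡r)) even
  ... | ()
  residue 3 _ n≡r with trans (sym (%4-parity n n≡r)) even
  ... | ()
  residue (suc (suc (suc (suc _)))) (s≤s (s≤s (s≤s (s≤s ())))) _

odd-mod4 : ∀ n → n % 2 ≡ 1 → n % 4 ≡ 1 ⊎ n % 4 ≡ 3
odd-mod4 n odd = residue (n % 4) (m%n<n n 4) refl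
  where
  residue : ∀ r → r < 4 → n % 4 ≡ r → n % 4 ≡ 1 ⊎ n % 4 ≡ 3
  residue 1 _ n≡r = inj₁ n≡r
  residue 3 _ n≡r = inj₂ n≡r
  residue 0 _ n≡r with trans (sym (%4-parity n n≡r)) odd
  ... | ()
  residue 2 _ n≡r with trans (sym (%4-parity n n≡r)) odd
  ... | ()
  residue (suc (suc (suc (suc _)))) (s≤s (s≤s (s≤s (s≤s ())))) _

even+odd+odd : ∀ e q o → e % 2 ≡ 0 → q % 2 ≡ 1 → o % 2 ≡ 1 → (e + q + o) % 2 ≡ 0
even+odd+odd e q o e-even q-odd o-odd = +-mod 2 (e + q) o (+-mod 2 e q e-even q-odd) o-odd

plus-two-mod4 : ∀ t s → s % 4 ≡ 2 → (t + s) % 4 ≡ 2 → t % 4 ≡ 0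
plus-two-mod4 t s s≡2 t+s≡2 = residue (t % 4) (m%n<n t 4) (trans (sym (+-mod 4 t s refl s≡2)) t+s≡2)
  where
  residue : ∀ r → r < 4 → (r + 2) % 4 ≡ 2 → r ≡ 0
  residue 0 _ _ = refl
  residue 1 _ ()
  residue 2 _ ()
  residue 3 _ ()
  residue (suc (suc (suc (suc _)))) (s≤s (s≤s (s≤s (s≤s ())))) _

even-summands-mod4 : ∀ a b → a % 2 ≡ 0 → (a + b) % 4 ≡ 2 → a % 4 ≡ 0 ⊎ b % 4 ≡ 0
even-summands-mod4 a b a-even a+b≡2 with even-mod4 a a-even
... | inj₁ a≡0 = inj₁ a≡0
... | inj₂ a≡2 = inj₂ (plus-two-mod4 b a a≡2 (trans (cong (_% 4) (+-comm b a)) a+b≡2))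

double-even-mod4 : ∀ q → q % 2 ≡ 0 → (q + q) % 4 ≡ 0
double-even-mod4 q q-even with even-mod4 q q-even
... | inj₁ q≡0 = +-mod 4 q q q≡0 q≡0
... | inj₂ q≡2 = +-mod 4 q q q≡2 q≡2

congruent-odd-sum-mod4 : ∀ ℓ ℓ′ → ℓ % 2 ≡ 1 → ℓ % 4 ≡ ℓ′ % 4 → (ℓ + ℓ′) % 4 ≡ 2
congruent-odd-sum-mod4 ℓ ℓ′ ℓ-odd same with odd-mod4 ℓ ℓ-odd
... | inj₁ ℓ≡1 = +-mod 4 ℓ ℓ′ ℓ≡1 (trans (sym same) ℓ≡1)
... | inj₂ ℓ≡3 = +-mod 4 ℓ ℓ′ ℓ≡3 (trans (sym same) ℓ≡3)

two-choices-mod4 : ∀ e o e′ o′ q {ℓ ℓ′} → e % 2 ≡ 0 → e′ % 2 ≡ 0 → q % 2 ≡ 0 →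
                   e + o ≡ ℓ → e′ + o′ ≡ ℓ′ → ℓ % 2 ≡ 1 → ℓ % 4 ≡ ℓ′ % 4 →
                   (e + q + e′) % 4 ≡ 0 ⊎ (o + q + o′) % 4 ≡ 0
two-choices-mod4 e o e′ o′ q e-even e′-even q-even refl refl ℓ-odd same =
  even-summands-mod4 (e + q + e′) (o + q + o′) (+-mod 2 (e + q) e′ (+-mod 2 e q e-even q-even) e′-even)
    (trans (cong (_% 4) (rearrange e o e′ o′ q))
           (+-mod 4 (q + q) _ (double-even-mod4 q q-even) (congruent-odd-sum-mod4 (e + o) (e′ + o′) ℓ-odd same)))
  where
  rearrange : ∀ e o e′ o′ q → e + q + e′ + (o + q + o′) ≡ (q + q) + ((e + o) + (e′ + o′))
  rearrange = solve-∀

sum-of-three-mod4 : ∀ a b c → a % 4 ≡ 2 → b % 4 ≡ 2 → c % 4 ≡ 2 → (a + b + c) % 4 ≡ 2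
sum-of-three-mod4 a b c a≡2 b≡2 c≡2 = +-mod 4 (a + b) c (+-mod 4 a b a≡2 b≡2) c≡2

triangle-mod4 : ∀ e₀ e₁ e₂ o₀ o₁ o₂ q₀ q₁ q₂ d₀ d₁ d₂ L₀ L₁ L₂ →
                L₀ ≡ q₀ + d₁ + q₁ → L₁ ≡ q₁ + d₂ + q₂ → L₂ ≡ q₂ + d₀ + q₀ →
                (e₀ + q₀ + o₀) % 4 ≡ 2 → (e₁ + q₁ + o₁) % 4 ≡ 2 → (e₂ + q₂ + o₂) % 4 ≡ 2 →
                (e₀ + L₀ + o₁) % 4 ≡ 2 → (e₁ + L₁ + o₂) % 4 ≡ 2 → (e₂ + L₂ + o₀) % 4 ≡ 2 →
                (L₀ + d₂ + (q₂ + d₀)) % 4 ≡ 0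
triangle-mod4 e₀ e₁ e₂ o₀ o₁ o₂ q₀ q₁ q₂ d₀ d₁ d₂ _ _ _ refl refl refl A₀ A₁ A₂ B₀ B₁ B₂ =
  plus-two-mod4 (q₀ + d₁ + q₁ + d₂ + (q₂ + d₀)) (e₀ + q₀ + o₀ + (e₁ + q₁ + o₁) + (e₂ + q₂ + o₂))
    (sum-of-three-mod4 (e₀ + q₀ + o₀) (e₁ + q₁ + o₁) (e₂ + q₂ + o₂) A₀ A₁ A₂)
    (trans (cong (_% 4) (rearrange e₀ e₁ e₂ o₀ o₁ o₂ q₀ q₁ q₂ d₀ d₁ d₂))
           (sum-of-three-mod4 (e₀ + (q₀ + d₁ + q₁) + o₁) (e₁ + (q₁ + d₂ + q₂) + o₂) (e₂ + (q₂ + d₀ + q₀) + o₀)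
                              B₀ B₁ B₂))
  where
  rearrange : ∀ e₀ e₁ e₂ o₀ o₁ o₂ q₀ q₁ q₂ d₀ d₁ d₂ →
              q₀ + d₁ + q₁ + d₂ + (q₂ + d₀) + (e₀ + q₀ + o₀ + (e₁ + q₁ + o₁) + (e₂ + q₂ + o₂))
              ≡ e₀ + (q₀ + d₁ + q₁) + o₁ + (e₁ + (q₁ + d₂ + q₂) + o₂) + (e₂ + (q₂ + d₀ + q₀) + o₀)
  rearrange = solve-∀

module _ (G : Graph) (x : V G) (Edge : Rel (V G) 0ℓ)
         (Edge-sym : Symmetric Edge) (Edge⇒Adj : Edge ⇒ Graph.Adj G) where

  CycleOfLength : ℕ → Set
  CycleOfLength n = Σ[ D ∈ Cycle G ] (∀ u v → CycleEdge G D u v → Edge u v) × cycleLength G D ≡ n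

  DivisibleCycle : Set
  DivisibleCycle = Σ[ D ∈ Cycle G ] (∀ u v → CycleEdge G D u v → Edge u v) × 4 ∣ cycleLength G D

  divisible : ∀ {n} → CycleOfLength n → n % 4 ≡ 0 → DivisibleCycle
  divisible (D , edges , refl) ≡0 = D , edges , m%n≡0⇒n∣m _ 4 ≡0

  circuitCycle : ∀ {P y} (c : Circuit Edge P y) → 3 ≤ len (Circuit.walk c) → CycleOfLength (len (Circuit.walk c))
  circuitCycle c = toCycle G Edge-sym Edge⇒Adj (Circuit.walk c) (Circuit.unique c)

  record ArcPair (C : Cycle G) (s t : V G) : Set where
    field
      even odd  : SimplePath Edge (onCycle G C) s t
      even-even : ∣ even ∣ % 2 ≡ 0
      odd-odd   : ∣ odd ∣ % 2 ≡ 1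
      total     : ∣ even ∣ + ∣ odd ∣ ≡ cycleLength G C

  sortByParity : ∀ {C s t} (p q : SimplePath Edge (onCycle G C) s t) →
                 ∣ p ∣ + ∣ q ∣ ≡ cycleLength G C → cycleLength G C % 2 ≡ 1 → ArcPair C s t
  sortByParity p q total ℓ-odd with parity-split ∣ p ∣ ∣ q ∣ (subst (λ n → n % 2 ≡ 1) (sym total) ℓ-odd)
  ... | inj₁ (p-even , q-odd) = record { even = p ; odd = q ; even-even = p-even ; odd-odd = q-odd ; total = total }
  ... | inj₂ (p-odd , q-even) = record { even = q ; odd = p ; even-even = q-even ; odd-odd = p-odd
                                       ; total = trans (+-comm ∣ q ∣ ∣ p ∣) total }

  module _ {C : Cycle G} (C⊆Edge : CycleEdge G C ⇒ Edge) (x∈C : InCycle G x C)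
           (ℓ-odd : cycleLength G C % 2 ≡ 1) {t : V G} (t∈C : InCycle G t C) (t≢x : t ≢ x) where

    private
      halves = arcs G C x∈C t∈C t≢x
      p = mapEdges C⊆Edge (proj₁ halves)
      q = mapEdges C⊆Edge (proj₁ (proj₂ halves))
      total : ∣ p ∣ + ∣ q ∣ ≡ cycleLength G C
      total = trans (cong₂ _+_ (∣mapEdges∣ C⊆Edge (proj₁ halves)) (∣mapEdges∣ C⊆Edge (proj₁ (proj₂ halves))))
                    (proj₂ (proj₂ halves))

    arcsFrom : ArcPair C x t
    arcsFrom = sortByParity p q total ℓ-odd

    arcsTo : ArcPair C t x
    arcsTo = sortByParity (reversed Edge-sym p) (reversed Edge-sym q)
               (trans (cong₂ _+_ (∣reversed∣ Edge-sym p) (∣reversed∣ Edge-sym q)) total) ℓ-odd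

  open ArcPair

  record Bridge (X Y : Cycle G) : Set₁ where
    field
      {from to}   : V G
      {zone}      : Pred (V G) 0ℓ
      path        : SimplePath Edge zone from to
      from∈X      : InCycle G from X
      to∈Y        : InCycle G to Y
      from≢x      : from ≢ x
      to≢x        : to ≢ x
      zone∩X⊆from : zone ∩ onCycle G X ⊆ ｛ from ｝
      zone∩Y⊆to   : zone ∩ onCycle G Y ⊆ ｛ to ｝

  module _ {X Y : Cycle G} (X∩Y⊆x : onCycle G X ∩ onCycle G Y ⊆ ｛ x ｝) (β : Bridge X Y) where
    open Bridge β

    bridgeCycle : (α : SimplePath Edge (onCycle G X) x from) (γ : SimplePath Edge (onCycle G Y) to x) →
                  CycleOfLength (∣ α ∣ + ∣ path ∣ + ∣ γ ∣)
    bridgeCycle α γ = subst CycleOfLength lengths (circuitCycle c (subst (3 ≤_) (sym lengths) three))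
      where
      X∩zone⊆from : onCycle G X ∩ zone ⊆ ｛ from ｝
      X∩zone⊆from (v∈X , v∈zone) = zone∩X⊆from (v∈zone , v∈X)
      αβ = join α path X∩zone⊆from
      meets : (onCycle G X ∪ zone) ∩ onCycle G Y ⊆ ｛ x ｝ ∪ ｛ to ｝
      meets (inj₁ v∈X , v∈Y) = inj₁ (X∩Y⊆x (v∈X , v∈Y))
      meets (inj₂ v∈Z , v∈Y) = inj₂ (zone∩Y⊆to (v∈Z , v∈Y))
      c = close αβ γ meets
      lengths : len (Circuit.walk c) ≡ ∣ α ∣ + ∣ path ∣ + ∣ γ ∣
      lengths = trans (len-◅◅ (walk αβ) (walk γ)) (cong (_+ ∣ γ ∣) (len-◅◅ (walk α) (walk path)))
      three : 3 ≤ ∣ α ∣ + ∣ path ∣ + ∣ γ ∣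
      three = +-mono-≤ (+-mono-≤ (len-positive (from≢x ∘ sym) (walk α))
                                 (len-positive (apart G X Y X∩Y⊆x from∈X to∈Y from≢x) (walk path)))
                       (len-positive to≢x (walk γ))

    evenBridge : ArcPair X x from → ArcPair Y to x → cycleLength G X % 2 ≡ 1 →
                 cycleLength G X % 4 ≡ cycleLength G Y % 4 → ∣ path ∣ % 2 ≡ 0 → DivisibleCycle
    evenBridge outward inward ℓ-odd same q-even
      with two-choices-mod4 (∣ even outward ∣) (∣ odd outward ∣) (∣ even inward ∣) (∣ odd inward ∣) (∣ path ∣)
             (even-even outward) (even-even inward) q-even (total outward) (total inward) ℓ-odd same
    ... | inj₁ ≡0 = divisible (bridgeCycle (even outward) (even inward)) ≡0
    ... | inj₂ ≡0 = divisible (bridgeCycle (odd outward) (odd inward)) ≡0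

    oddBridge : (outward : ArcPair X x from) (inward : ArcPair Y to x) → ∣ path ∣ % 2 ≡ 1 →
                (∣ even outward ∣ + ∣ path ∣ + ∣ odd inward ∣) % 4 ≡ 2 ⊎ DivisibleCycle
    oddBridge outward inward q-odd
      with even-mod4 (∣ even outward ∣ + ∣ path ∣ + ∣ odd inward ∣)
             (even+odd+odd (∣ even outward ∣) (∣ path ∣) (∣ odd inward ∣) (even-even outward) q-odd (odd-odd inward))
    ... | inj₁ ≡0 = inj₂ (divisible (bridgeCycle (even outward) (odd inward)) ≡0)
    ... | inj₂ ≡2 = inj₁ ≡2

  record Configuration : Set where
    field
      C₁ C₂ C₃   : Cycle G
      P₁ P₂ P₃   : Path G
      odd₁       : cycleLength G C₁ % 2 ≡ 1
      odd₂       : cycleLength G C₂ % 2 ≡ 1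
      odd₃       : cycleLength G C₃ % 2 ≡ 1
      same₁₂     : cycleLength G C₁ % 4 ≡ cycleLength G C₂ % 4
      same₂₃     : cycleLength G C₂ % 4 ≡ cycleLength G C₃ % 4
      same₃₁     : cycleLength G C₃ % 4 ≡ cycleLength G C₁ % 4
      meet₁₂     : MeetExactlyIn G C₁ C₂ x
      meet₂₃     : MeetExactlyIn G C₂ C₃ x
      meet₃₁     : MeetExactlyIn G C₃ C₁ x
      between₁   : PathBetween G P₁ C₁ C₂
      between₂   : PathBetween G P₂ C₂ C₃
      between₃   : PathBetween G P₃ C₃ C₁
      avoids₁    : VertexDisjointPC G P₁ C₃
      avoids₂    : VertexDisjointPC G P₂ C₁
      avoids₃    : VertexDisjointPC G P₃ C₂
      disjoint₁₂ : InternallyDisjoint G P₁ P₂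
      disjoint₂₃ : InternallyDisjoint G P₂ P₃
      disjoint₃₁ : InternallyDisjoint G P₃ P₁
      C₁⊆Edge    : CycleEdge G C₁ ⇒ Edge
      C₂⊆Edge    : CycleEdge G C₂ ⇒ Edge
      C₃⊆Edge    : CycleEdge G C₃ ⇒ Edge
      P₁⊆Edge    : PathEdge G P₁ ⇒ Edge
      P₂⊆Edge    : PathEdge G P₂ ⇒ Edge
      P₃⊆Edge    : PathEdge G P₃ ⇒ Edge

  -- shift (shift (shift cfg)) reduces to cfg by record η, so the data built for the three
  -- shifts of one configuration fit together definitionally.
  shift : Configuration → Configuration
  shift cfg = record
    { C₁ = C₂ ; C₂ = C₃ ; C₃ = C₁ ; P₁ = P₂ ; P₂ = P₃ ; P₃ = P₁
    ; odd₁ = odd₂ ; odd₂ = odd₃ ; odd₃ = odd₁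
    ; same₁₂ = same₂₃ ; same₂₃ = same₃₁ ; same₃₁ = same₁₂
    ; meet₁₂ = meet₂₃ ; meet₂₃ = meet₃₁ ; meet₃₁ = meet₁₂
    ; between₁ = between₂ ; between₂ = between₃ ; between₃ = between₁
    ; avoids₁ = avoids₂ ; avoids₂ = avoids₃ ; avoids₃ = avoids₁
    ; disjoint₁₂ = disjoint₂₃ ; disjoint₂₃ = disjoint₃₁ ; disjoint₃₁ = disjoint₁₂
    ; C₁⊆Edge = C₂⊆Edge ; C₂⊆Edge = C₃⊆Edge ; C₃⊆Edge = C₁⊆Edge
    ; P₁⊆Edge = P₂⊆Edge ; P₂⊆Edge = P₃⊆Edge ; P₃⊆Edge = P₁⊆Edge
    }
    where open Configuration cfg

  module _ (cfg : Configuration) where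
    open Configuration cfg

    x∈C₁ : InCycle G x C₁
    x∈C₁ = proj₁ meet₁₂

    C₁∩C₂⊆x : onCycle G C₁ ∩ onCycle G C₂ ⊆ ｛ x ｝
    C₁∩C₂⊆x (v∈C₁ , v∈C₂) = sym (proj₂ (proj₂ meet₁₂) _ v∈C₁ v∈C₂)

    oriented : Oriented G P₁ C₁ C₂
    oriented = orient G between₁

    open Oriented oriented public using (from; to)

    -- Opaque, like the arcs and detours below, so that comparing lengths of cycles built at
    -- different shifts never unfolds the walk constructions.
    opaque
      route : SimplePath Edge (onPath G P₁) from to
      route = mapEdges P₁⊆Edge (Oriented.route oriented)

    from∈P₁ : InPath G from P₁
    from∈P₁ = inside route (here refl)

    to∈P₁ : InPath G to P₁
    to∈P₁ = inside route (end∈vertices (walk route))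

    from∈C₁ : InCycle G from C₁
    from∈C₁ = Oriented.from∈X oriented

    to∈C₂ : InCycle G to C₂
    to∈C₂ = Oriented.to∈Y oriented

    P₁-avoids-x : ∀ {v} → InPath G v P₁ → v ≢ x
    P₁-avoids-x v∈P₁ refl = avoids₁ _ v∈P₁ (proj₁ meet₃₁)

    from≢x : from ≢ x
    from≢x = P₁-avoids-x from∈P₁

    to≢x : to ≢ x
    to≢x = P₁-avoids-x to∈P₁

    route-positive : 1 ≤ ∣ route ∣
    route-positive = len-positive (apart G C₁ C₂ C₁∩C₂⊆x from∈C₁ to∈C₂ from≢x) (walk route)

    P₁∩C₁⊆from : onPath G P₁ ∩ onCycle G C₁ ⊆ ｛ from ｝
    P₁∩C₁⊆from (v∈P₁ , v∈C₁) with Oriented.meets oriented (v∈P₁ , inj₁ v∈C₁)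
    ... | inj₁ from≡v = from≡v
    ... | inj₂ refl   = ⊥-elim (to≢x (sym (C₁∩C₂⊆x (v∈C₁ , to∈C₂))))

    P₁∩C₂⊆to : onPath G P₁ ∩ onCycle G C₂ ⊆ ｛ to ｝
    P₁∩C₂⊆to (v∈P₁ , v∈C₂) with Oriented.meets oriented (v∈P₁ , inj₂ v∈C₂)
    ... | inj₁ refl = ⊥-elim (from≢x (sym (C₁∩C₂⊆x (from∈C₁ , v∈C₂))))
    ... | inj₂ to≡v = to≡v

    P₁∩P₂⊆C₂ : onPath G P₁ ∩ onPath G P₂ ⊆ onCycle G C₂
    P₁∩P₂⊆C₂ {v} (v∈P₁ , v∈P₂) with Oriented.ends oriented (proj₁ (disjoint₁₂ v v∈P₁ v∈P₂))
    ... | inj₁ refl = ⊥-elim (avoids₂ v v∈P₂ from∈C₁)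
    ... | inj₂ refl = to∈C₂

  module _ (cfg : Configuration) where
    open Configuration cfg

    shortBridge : Bridge C₁ C₂
    shortBridge = record
      { path        = route cfg
      ; from∈X      = from∈C₁ cfg
      ; to∈Y        = to∈C₂ cfg
      ; from≢x      = from≢x cfg
      ; to≢x        = to≢x cfg
      ; zone∩X⊆from = P₁∩C₁⊆from cfg
      ; zone∩Y⊆to   = P₁∩C₂⊆to cfg
      }

    opaque
      leaving : ArcPair C₁ x (from cfg)
      leaving = arcsFrom C₁⊆Edge (x∈C₁ cfg) odd₁ (from∈C₁ cfg) (from≢x cfg)

    opaque
      arriving : ArcPair C₂ (to cfg) x
      arriving = arcsTo C₂⊆Edge (x∈C₁ (shift cfg)) odd₂ (to∈C₂ cfg) (to≢x cfg)

    opaque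
      detour : SimplePath Edge (onCycle G C₁ ∖ ｛ x ｝) (to (shift (shift cfg))) (from cfg)
      detour = mapEdges C₁⊆Edge (arcAvoiding G C₁ (x∈C₁ cfg) (to∈C₂ (shift (shift cfg))) (to≢x (shift (shift cfg)))
                                                            (from∈C₁ cfg) (from≢x cfg))

  module _ (cfg : Configuration) where
    open Configuration cfg

    longBridge : Bridge C₁ C₃
    longBridge = record
      { path        = join (join (route cfg) (detour (shift cfg)) junction-to) (route (shift cfg)) junction-from₂
      ; from∈X      = from∈C₁ cfg
      ; to∈Y        = to∈C₂ (shift cfg)
      ; from≢x      = from≢x cfg
      ; to≢x        = to≢x (shift cfg)
      ; zone∩X⊆from = zone∩C₁⊆from
      ; zone∩Y⊆to   = zone∩C₃⊆to₂
      }
      where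
      junction-to : onPath G P₁ ∩ (onCycle G C₂ ∖ ｛ x ｝) ⊆ ｛ to cfg ｝
      junction-to (v∈P₁ , v∈C₂ , _) = P₁∩C₂⊆to cfg (v∈P₁ , v∈C₂)
      junction-from₂ : (onPath G P₁ ∪ (onCycle G C₂ ∖ ｛ x ｝)) ∩ onPath G P₂ ⊆ ｛ from (shift cfg) ｝
      junction-from₂ (inj₁ v∈P₁ , v∈P₂)       = P₁∩C₁⊆from (shift cfg) (v∈P₂ , P₁∩P₂⊆C₂ cfg (v∈P₁ , v∈P₂))
      junction-from₂ (inj₂ (v∈C₂ , _) , v∈P₂) = P₁∩C₁⊆from (shift cfg) (v∈P₂ , v∈C₂)
      zone∩C₁⊆from : ((onPath G P₁ ∪ (onCycle G C₂ ∖ ｛ x ｝)) ∪ onPath G P₂) ∩ onCycle G C₁ ⊆ ｛ from cfg ｝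
      zone∩C₁⊆from (inj₁ (inj₁ v∈P₁) , v∈C₁)         = P₁∩C₁⊆from cfg (v∈P₁ , v∈C₁)
      zone∩C₁⊆from (inj₁ (inj₂ (v∈C₂ , x≢v)) , v∈C₁) = ⊥-elim (x≢v (C₁∩C₂⊆x cfg (v∈C₁ , v∈C₂)))
      zone∩C₁⊆from (inj₂ v∈P₂ , v∈C₁)                = ⊥-elim (avoids₂ _ v∈P₂ v∈C₁)
      zone∩C₃⊆to₂ : ((onPath G P₁ ∪ (onCycle G C₂ ∖ ｛ x ｝)) ∪ onPath G P₂) ∩ onCycle G C₃ ⊆ ｛ to (shift cfg) ｝
      zone∩C₃⊆to₂ (inj₁ (inj₁ v∈P₁) , v∈C₃)         = ⊥-elim (avoids₁ _ v∈P₁ v∈C₃)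
      zone∩C₃⊆to₂ (inj₁ (inj₂ (v∈C₂ , x≢v)) , v∈C₃) = ⊥-elim (x≢v (C₁∩C₂⊆x (shift cfg) (v∈C₂ , v∈C₃)))
      zone∩C₃⊆to₂ (inj₂ v∈P₂ , v∈C₃)                = P₁∩C₂⊆to (shift cfg) (v∈P₂ , v∈C₃)

  module _ (cfg : Configuration) where
    open Configuration cfg

    private
      cfg² = shift (shift cfg)
      long = Bridge.path (longBridge cfg)

    ∣longBridge∣ : ∣ long ∣ ≡ ∣ route cfg ∣ + ∣ detour (shift cfg) ∣ + ∣ route (shift cfg) ∣
    ∣longBridge∣ = trans (len-◅◅ (walk (route cfg) ◅◅ walk (detour (shift cfg))) (walk (route (shift cfg))))
                         (cong (_+ ∣ route (shift cfg) ∣) (len-◅◅ (walk (route cfg)) (walk (detour (shift cfg)))))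

    triangleCycle : CycleOfLength (∣ long ∣ + ∣ detour cfg² ∣ + (∣ route cfg² ∣ + ∣ detour cfg ∣))
    triangleCycle = subst CycleOfLength lengths (circuitCycle c (subst (3 ≤_) (sym lengths) three))
      where
      junction-C₃ : Bridge.zone (longBridge cfg) ∩ (onCycle G C₃ ∖ ｛ x ｝) ⊆ ｛ to (shift cfg) ｝
      junction-C₃ (v∈Z , v∈C₃ , _) = Bridge.zone∩Y⊆to (longBridge cfg) (v∈Z , v∈C₃)
      junction-C₁ : onPath G P₃ ∩ (onCycle G C₁ ∖ ｛ x ｝) ⊆ ｛ to cfg² ｝
      junction-C₁ (v∈P₃ , v∈C₁ , _) = P₁∩C₂⊆to cfg² (v∈P₃ , v∈C₁)
      forth = join long (detour cfg²) junction-C₃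
      back  = join (route cfg²) (detour cfg) junction-C₁
      meets : (Bridge.zone (longBridge cfg) ∪ (onCycle G C₃ ∖ ｛ x ｝)) ∩ (onPath G P₃ ∪ (onCycle G C₁ ∖ ｛ x ｝))
              ⊆ ｛ from cfg ｝ ∪ ｛ from cfg² ｝
      meets (inj₁ (inj₁ (inj₁ v∈P₁)) , inj₁ v∈P₃) =
        inj₁ (P₁∩C₁⊆from cfg (v∈P₁ , P₁∩P₂⊆C₂ cfg² (v∈P₃ , v∈P₁)))
      meets (inj₁ (inj₁ (inj₂ (v∈C₂ , _))) , inj₁ v∈P₃) = ⊥-elim (avoids₃ _ v∈P₃ v∈C₂)
      meets (inj₁ (inj₂ v∈P₂) , inj₁ v∈P₃) =
        inj₂ (P₁∩C₁⊆from cfg² (v∈P₃ , P₁∩P₂⊆C₂ (shift cfg) (v∈P₂ , v∈P₃)))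
      meets (inj₁ v∈Z , inj₂ (v∈C₁ , _))          = inj₁ (Bridge.zone∩X⊆from (longBridge cfg) (v∈Z , v∈C₁))
      meets (inj₂ (v∈C₃ , _) , inj₁ v∈P₃)         = inj₂ (P₁∩C₁⊆from cfg² (v∈P₃ , v∈C₃))
      meets (inj₂ (v∈C₃ , x≢v) , inj₂ (v∈C₁ , _)) = ⊥-elim (x≢v (C₁∩C₂⊆x cfg² (v∈C₃ , v∈C₁)))
      c = close forth back meets
      lengths : len (Circuit.walk c) ≡ ∣ long ∣ + ∣ detour cfg² ∣ + (∣ route cfg² ∣ + ∣ detour cfg ∣)
      lengths = trans (len-◅◅ (walk forth) (walk back))
                      (cong₂ _+_ (len-◅◅ (walk long) (walk (detour cfg²))) (len-◅◅ (walk (route cfg²)) (walk (detour cfg))))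
      three : 3 ≤ ∣ long ∣ + ∣ detour cfg² ∣ + (∣ route cfg² ∣ + ∣ detour cfg ∣)
      three = subst (λ L → 3 ≤ L + ∣ detour cfg² ∣ + (∣ route cfg² ∣ + ∣ detour cfg ∣)) (sym ∣longBridge∣)
                (+-mono-≤ (+-mono-≤ (+-mono-≤ (+-mono-≤ (route-positive cfg) z≤n) (route-positive (shift cfg))) z≤n)
                          (+-mono-≤ (route-positive cfg²) z≤n))

  module _ (cfg : Configuration) where
    open Configuration cfg

    C₁∩C₃⊆x : onCycle G C₁ ∩ onCycle G C₃ ⊆ ｛ x ｝
    C₁∩C₃⊆x (v∈C₁ , v∈C₃) = C₁∩C₂⊆x (shift (shift cfg)) (v∈C₃ , v∈C₁)

    evenShortBridge : ∣ route cfg ∣ % 2 ≡ 0 → DivisibleCycle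
    evenShortBridge = evenBridge (C₁∩C₂⊆x cfg) (shortBridge cfg) (leaving cfg) (arriving cfg) odd₁ same₁₂

    evenLongBridge : ∣ Bridge.path (longBridge cfg) ∣ % 2 ≡ 0 → DivisibleCycle
    evenLongBridge = evenBridge C₁∩C₃⊆x (longBridge cfg) (leaving cfg) (arriving (shift cfg)) odd₁ (sym same₃₁)

    oddShortBridge : ∣ route cfg ∣ % 2 ≡ 1 →
               (∣ even (leaving cfg) ∣ + ∣ route cfg ∣ + ∣ odd (arriving cfg) ∣) % 4 ≡ 2 ⊎ DivisibleCycle
    oddShortBridge = oddBridge (C₁∩C₂⊆x cfg) (shortBridge cfg) (leaving cfg) (arriving cfg)

    oddLongBridge : ∣ Bridge.path (longBridge cfg) ∣ % 2 ≡ 1 →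
              (∣ even (leaving cfg) ∣ + ∣ Bridge.path (longBridge cfg) ∣ + ∣ odd (arriving (shift cfg)) ∣) % 4 ≡ 2
              ⊎ DivisibleCycle
    oddLongBridge = oddBridge C₁∩C₃⊆x (longBridge cfg) (leaving cfg) (arriving (shift cfg))

  otherwise : ∀ {A : Set} → A ⊎ DivisibleCycle → (A → DivisibleCycle) → DivisibleCycle
  otherwise r k = [ k , id ]′ r

  byParity : ∀ n → (n % 2 ≡ 0 → DivisibleCycle) → (n % 2 ≡ 1 → DivisibleCycle) → DivisibleCycle
  byParity n if-even if-odd = [ if-even , if-odd ]′ (parity n)

  allBridgesOdd : (cfg : Configuration) →
                  ∣ route cfg ∣ % 2 ≡ 1 → ∣ route (shift cfg) ∣ % 2 ≡ 1 → ∣ route (shift (shift cfg)) ∣ % 2 ≡ 1 →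
                  ∣ Bridge.path (longBridge cfg) ∣ % 2 ≡ 1 → ∣ Bridge.path (longBridge (shift cfg)) ∣ % 2 ≡ 1 →
                  ∣ Bridge.path (longBridge (shift (shift cfg))) ∣ % 2 ≡ 1 → DivisibleCycle
  allBridgesOdd cfg q₀ q₁ q₂ L₀ L₁ L₂ =
    otherwise (oddShortBridge cfg q₀) λ A₀ →
    otherwise (oddShortBridge cfg₁ q₁) λ A₁ →
    otherwise (oddShortBridge cfg₂ q₂) λ A₂ →
    otherwise (oddLongBridge cfg L₀) λ B₀ →
    otherwise (oddLongBridge cfg₁ L₁) λ B₁ →
    otherwise (oddLongBridge cfg₂ L₂) λ B₂ →
    divisible (triangleCycle cfg)
      (triangle-mod4 (e cfg) (e cfg₁) (e cfg₂) (o cfg) (o cfg₁) (o cfg₂) (q cfg) (q cfg₁) (q cfg₂)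
                     (d cfg) (d cfg₁) (d cfg₂) (L cfg) (L cfg₁) (L cfg₂)
                     (∣longBridge∣ cfg) (∣longBridge∣ cfg₁) (∣longBridge∣ cfg₂) A₀ A₁ A₂ B₀ B₁ B₂)
    where
    cfg₁ = shift cfg
    cfg₂ = shift cfg₁
    e o q d L : Configuration → ℕ
    e c = ∣ even (leaving c) ∣
    o c = ∣ odd (arriving c) ∣
    q c = ∣ route c ∣
    d c = ∣ detour c ∣
    L c = ∣ Bridge.path (longBridge c) ∣

  divisibleCycle : Configuration → DivisibleCycle
  divisibleCycle cfg =
    byParity ∣ route cfg ∣ (evenShortBridge cfg) λ q₀ →
    byParity ∣ route cfg₁ ∣ (evenShortBridge cfg₁) λ q₁ →
    byParity ∣ route cfg₂ ∣ (evenShortBridge cfg₂) λ q₂ →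
    byParity ∣ Bridge.path (longBridge cfg) ∣ (evenLongBridge cfg) λ L₀ →
    byParity ∣ Bridge.path (longBridge cfg₁) ∣ (evenLongBridge cfg₁) λ L₁ →
    byParity ∣ Bridge.path (longBridge cfg₂) ∣ (evenLongBridge cfg₂) λ L₂ →
    allBridgesOdd cfg q₀ q₁ q₂ L₀ L₁ L₂
    where
    cfg₁ = shift cfg
    cfg₂ = shift cfg₁

module _ (G : Graph) (C₁ C₂ C₃ : Cycle G) (P₁ P₂ P₃ : Path G) where

  Union : Rel (V G) 0ℓ
  Union u v = CycleEdge G C₁ u v ⊎ CycleEdge G C₂ u v ⊎ CycleEdge G C₃ u v
              ⊎ PathEdge G P₁ u v ⊎ PathEdge G P₂ u v ⊎ PathEdge G P₃ u v

  Union-sym : Symmetric Union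
  Union-sym = Data.Sum.map (CycleEdge-sym G C₁) (Data.Sum.map (CycleEdge-sym G C₂) (Data.Sum.map (CycleEdge-sym G C₃)
                (Data.Sum.map (PathEdge-sym G P₁) (Data.Sum.map (PathEdge-sym G P₂) (PathEdge-sym G P₃)))))

  Union⇒Adj : Union ⇒ Graph.Adj G
  Union⇒Adj = [ CycleEdge⇒Adj G C₁ , [ CycleEdge⇒Adj G C₂ , [ CycleEdge⇒Adj G C₃
              , [ PathEdge⇒Adj G P₁ , [ PathEdge⇒Adj G P₂ , PathEdge⇒Adj G P₃ ]′ ]′ ]′ ]′ ]′

lemma7 : (G : Graph) (x : V G) (C₁ C₂ C₃ : Cycle G) (P₁ P₂ P₃ : Path G)
    → cycleLength G C₁ % 2 ≡ 1
    → cycleLength G C₂ % 2 ≡ 1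
    → cycleLength G C₃ % 2 ≡ 1
    → cycleLength G C₁ % 4 ≡ cycleLength G C₂ % 4
    → cycleLength G C₂ % 4 ≡ cycleLength G C₃ % 4
    → MeetExactlyIn G C₁ C₂ x
    → MeetExactlyIn G C₂ C₃ x
    → MeetExactlyIn G C₃ C₁ x
    → PathBetween G P₁ C₁ C₂
    → PathBetween G P₂ C₂ C₃
    → PathBetween G P₃ C₃ C₁
    → VertexDisjointPC G P₁ C₃
    → VertexDisjointPC G P₂ C₁
    → VertexDisjointPC G P₃ C₂
    → InternallyDisjoint G P₁ P₂
    → InternallyDisjoint G P₂ P₃
    → InternallyDisjoint G P₃ P₁
    → Σ (Cycle G) λ D →
        (∀ u v → CycleEdge G D u v →
           CycleEdge G C₁ u v ⊎ CycleEdge G C₂ u v ⊎ CycleEdge G C₃ u v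
           ⊎ PathEdge G P₁ u v ⊎ PathEdge G P₂ u v ⊎ PathEdge G P₃ u v)
        × 4 ∣ cycleLength G D
lemma7 G x C₁ C₂ C₃ P₁ P₂ P₃ odd₁ odd₂ odd₃ same₁₂ same₂₃ meet₁₂ meet₂₃ meet₃₁
       between₁ between₂ between₃ avoids₁ avoids₂ avoids₃ disjoint₁₂ disjoint₂₃ disjoint₃₁ =
  divisibleCycle G x (Union G C₁ C₂ C₃ P₁ P₂ P₃) (Union-sym G C₁ C₂ C₃ P₁ P₂ P₃)
                     (Union⇒Adj G C₁ C₂ C₃ P₁ P₂ P₃)
    record
      { C₁ = C₁ ; C₂ = C₂ ; C₃ = C₃ ; P₁ = P₁ ; P₂ = P₂ ; P₃ = P₃
      ; odd₁ = odd₁ ; odd₂ = odd₂ ; odd₃ = odd₃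
      ; same₁₂ = same₁₂ ; same₂₃ = same₂₃ ; same₃₁ = sym (trans same₁₂ same₂₃)
      ; meet₁₂ = meet₁₂ ; meet₂₃ = meet₂₃ ; meet₃₁ = meet₃₁
      ; between₁ = between₁ ; between₂ = between₂ ; between₃ = between₃
      ; avoids₁ = avoids₁ ; avoids₂ = avoids₂ ; avoids₃ = avoids₃
      ; disjoint₁₂ = disjoint₁₂ ; disjoint₂₃ = disjoint₂₃ ; disjoint₃₁ = disjoint₃₁
      ; C₁⊆Edge = inj₁ ; C₂⊆Edge = inj₂ ∘ inj₁ ; C₃⊆Edge = inj₂ ∘ inj₂ ∘ inj₁
      ; P₁⊆Edge = inj₂ ∘ inj₂ ∘ inj₂ ∘ inj₁ ; P₂⊆Edge = inj₂ ∘ inj₂ ∘ inj₂ ∘ inj₂ ∘ inj₁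
      ; P₃⊆Edge = inj₂ ∘ inj₂ ∘ inj₂ ∘ inj₂ ∘ inj₂
      }
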